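{- Let $b,c$ be nonzero constants, let $L$ be the Riordan array $\left(\frac{1}{1+ct},\frac{t(1-bt)}{1+ct}\right)$, and let $\mu_n$ ($n\ge0$) be the entries of the first column of $L^{ -1}$. Then for all $n\ge0$, $$\mu_n=0^n+c\sum_{k=0}^{n-1}\binom{n+k-1}{2k}c^{n-k-1}b^kC_k,$$ where $C_k=\frac{1}{k+1}\binom{2k}{k}$ and $0^0=1$.
   Context: For formal power series $g(t)=g_0+\cdots$ with $g_0\ne0$ and $f(t)=f_1t+\cdots$ with $f_1\ne0$, the Riordan array $(g,f)$ is the lower-triangular matrix with $(n,k)$ entry $[t^n]g(t)f(t)^k$. -}

module Defs where

open import Level using (Level)
open import Algebra.Bundles using (CommutativeRing)
open import Data.Nat as ℕ using (ℕ; zero; suc; _∸_; _≡ᵇ_)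
open import Data.Nat.Combinatorics using (_C_)
open import Data.Nat.DivMod using (_/_)
open import Data.List using (List; []; _∷_)
open import Data.Bool using (if_then_else_)

-- Catalan numbers C_k = (1/(k+1)) * binom(2k,k)  (exact division in ℕ)
catalan : ℕ → ℕ
catalan k = ((2 ℕ.* k) C k) / suc k

module Riordan {c ℓ : Level} (R : CommutativeRing c ℓ) where
  open CommutativeRing R

  Series : Set c
  Series = ℕ → Carrier

  sumTo : ℕ → (ℕ → Carrier) → Carrier
  sumTo zero    f = 0#
  sumTo (suc n) f = sumTo n f + f n

  fromℕ : ℕ → Carrier
  fromℕ zero    = 0#
  fromℕ (suc n) = 1# + fromℕ n

  -- powers in R (so 0^0 = 1)
  _^_ : Carrier → ℕ → Carrier
  x ^ zero  = 1#
  x ^ suc n = x * (x ^ n)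

  oneS : Series
  oneS zero    = 1#
  oneS (suc n) = 0#

  mulS : Series → Series → Series
  mulS a b n = sumTo (suc n) (λ i → a i * b (n ∸ i))

  powS : Series → ℕ → Series
  powS a zero    = oneS
  powS a (suc k) = mulS a (powS a k)

  -- multiplicative inverse of a series whose constant term is 1:
  -- h 0 = 1,  h (n+1) = - Σ_{i=1}^{n+1} a i * h (n+1-i).
  -- invList a n = [h n , h (n-1) , ... , h 0]
  private
    nth : List Carrier → ℕ → Carrier
    nth []       _       = 0#
    nth (x ∷ xs) zero    = x
    nth (x ∷ xs) (suc j) = nth xs j

  invList : Series → ℕ → List Carrier
  invList a zero    = 1# ∷ []
  invList a (suc n) = (- sumTo (suc n) (λ j → a (suc j) * nth (invList a n) j)) ∷ invList a n

  invUnitS : Series → Series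
  invUnitS a n = nth (invList a n) 0

  onePlus : Carrier → Series
  onePlus x zero          = 1#
  onePlus x (suc zero)    = x
  onePlus x (suc (suc n)) = 0#

  tOneMinus : Carrier → Series
  tOneMinus x zero                = 0#
  tOneMinus x (suc zero)          = 1#
  tOneMinus x (suc (suc zero))    = - x
  tOneMinus x (suc (suc (suc n))) = 0#

  riordan : Series → Series → ℕ → ℕ → Carrier
  riordan g f n k = mulS g (powS f k) n

  L : Carrier → Carrier → ℕ → ℕ → Carrier
  L b cc = riordan (invUnitS (onePlus cc)) (mulS (tOneMinus b) (invUnitS (onePlus cc)))

  δ : ℕ → ℕ → Carrier
  δ n k = if n ≡ᵇ k then 1# else 0#

  -- (A · M)(n,k) for A lower triangular (column index of A only up to n)
  lowerMul : (ℕ → ℕ → Carrier) → (ℕ → ℕ → Carrier) → ℕ → ℕ → Carrier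
  lowerMul A M n k = sumTo (suc n) (λ j → A n j * M j k)

  μFormula : Carrier → Carrier → ℕ → Carrier
  μFormula b cc n =
    (0# ^ n) + cc * sumTo n (λ k →
        fromℕ ((n ℕ.+ k ∸ 1) C (2 ℕ.* k)) * (cc ^ (n ∸ k ∸ 1)) * (b ^ k) * fromℕ (catalan k))

-- L⁻¹ is the Riordan array (1/g(F), F) = (1 + cF, F), where F is the compositional inverse of
-- f = t(1 - bt)/(1 + ct), i.e. F = t + ctF + bF². Rather than composing series, we compare
-- coefficient recurrences: those of F^(k+1) = tF^k + ctF^(k+1) + bF^(k+2) and of
-- (1 + ct)·g f^(k+1) = t(1 - bt)·g f^k give, by induction on the row, L·(1, F) = (1/(1 + ct), t).
-- Hence L maps the column 1 + cF to the first unit vector, and as L is unitriangular this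
-- determines the first column of any right inverse. Finally F = (t/(1 - ct))·C(bt/(1 - ct)²) for
-- the Catalan series C, which makes the coefficients of F sums of Catalan numbers times binomial
-- coefficients; the induction proving this runs over all powers F^r, whose coefficients involve
-- the ballot numbers [t^m] C^r.
module Submission where

open import Defs
open import Level using (Level)
open import Algebra.Bundles using (CommutativeRing)
open import Data.Nat as ℕ using (ℕ; zero; suc; _∸_; _<_; _≤_; s≤s)
import Data.Nat.Properties as ℕ
open import Data.Nat.Combinatorics using (_C_; nCn≡1)
open import Relation.Binary.PropositionalEquality as ≡ using (_≡_)
open import Relation.Nullary using (¬_)
import Algebra.Solver.Ring.NaturalCoefficients.Default as NaturalSolver

module Combinatorics where
  open import Data.Nat
  open import Data.Nat.Properties
  open import Data.Nat.Combinatorics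
  open import Data.Nat.DivMod using (_/_; m*n/n≡m)
  open import Data.Nat.Tactic.RingSolver using (solve-∀)
  open import Relation.Binary.PropositionalEquality
  open ≡-Reasoning

  double : ℕ → ℕ
  double zero    = zero
  double (suc m) = suc (suc (double m))

  double≡m+m : ∀ m → double m ≡ m + m
  double≡m+m zero    = refl
  double≡m+m (suc m) = cong suc (trans (cong suc (double≡m+m m)) (sym (+-suc m m)))

  -- ballot r m = [t^m] C(t)^(1+r) for the Catalan series C = 1 + t C²;
  -- the last clause is the coefficient form of C^(r+2) = C^(r+1) + t C^(r+3).
  ballot : ℕ → ℕ → ℕ
  ballot r       zero    = 1
  ballot zero    (suc m) = ballot 1 m
  ballot (suc r) (suc m) = ballot r (suc m) + ballot (suc (suc r)) m

  [1+2m]Cm≡[1+2m]C[1+m] : ∀ m → suc (double m) C m ≡ suc (double m) C suc m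
  [1+2m]Cm≡[1+2m]C[1+m] m = sym (begin
    suc (double m) C suc m              ≡⟨ nCk≡nC[n∸k] (s≤s m≤2m) ⟩
    suc (double m) C (double m ∸ m)     ≡⟨ cong (λ k → suc (double m) C (k ∸ m)) (double≡m+m m) ⟩
    suc (double m) C (m + m ∸ m)        ≡⟨ cong (suc (double m) C_) (m+n∸m≡n m m) ⟩
    suc (double m) C m                  ∎)
    where
    m≤2m : m ≤ double m
    m≤2m = subst (m ≤_) (sym (double≡m+m m)) (m≤m+n m m)

  ballot-pascal : ∀ {a a′} n k → a + n C suc k ≡ n C k → a′ + n C suc (suc k) ≡ n C suc k →
                  (a + a′) + suc n C suc (suc k) ≡ suc n C suc k
  ballot-pascal {a} {a′} n k eq eq′ = begin
    (a + a′) + suc n C suc (suc k)               ≡⟨ cong ((a + a′) +_) (sym (nCk+nC[k+1]≡[n+1]C[k+1] n (suc k))) ⟩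
    (a + a′) + (n C suc k + n C suc (suc k))     ≡⟨ +-interchange-middle a a′ (n C suc k) (n C suc (suc k)) ⟩
    (a + n C suc k) + (a′ + n C suc (suc k))     ≡⟨ cong₂ _+_ eq eq′ ⟩
    n C k + n C suc k                            ≡⟨ nCk+nC[k+1]≡[n+1]C[k+1] n k ⟩
    suc n C suc k                                ∎
    where
    +-interchange-middle : ∀ w x y z → (w + x) + (y + z) ≡ (w + y) + (x + z)
    +-interchange-middle = solve-∀

  ballot+C≡C : ∀ r m → ballot r m + (r + double m) C suc (r + m) ≡ (r + double m) C (r + m)
  ballot+C≡C r zero rewrite +-identityʳ r | k>n⇒nCk≡0 (n<1+n r) | nCn≡1 r = refl
  ballot+C≡C zero (suc m) = ballot-pascal (suc (double m)) m (sym ([1+2m]Cm≡[1+2m]C[1+m] m)) (ballot+C≡C 1 m)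
  ballot+C≡C (suc r) (suc m) =
    ballot-pascal (r + suc (suc (double m))) (r + suc m) (ballot+C≡C r (suc m))
      (subst₂ (λ n k → ballot (suc (suc r)) m + n C suc k ≡ n C k)
              (sym (trans (+-suc r (suc (double m))) (cong suc (+-suc r (double m)))))
              (sym (cong suc (+-suc r m)))
              (ballot+C≡C (suc (suc r)) m))

  [1+k]*[1+n]C[1+k]≡[1+n]*nCk : ∀ n k → suc k * (suc n C suc k) ≡ suc n * (n C k)
  [1+k]*[1+n]C[1+k]≡[1+n]*nCk zero zero = refl
  [1+k]*[1+n]C[1+k]≡[1+n]*nCk zero (suc k)
    rewrite k>n⇒nCk≡0 {1} {suc (suc k)} (s≤s (s≤s z≤n)) | *-zeroʳ k = refl
  [1+k]*[1+n]C[1+k]≡[1+n]*nCk (suc n) zero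
    rewrite +-identityʳ (suc (suc n) C 1) | nC1≡n (suc (suc n)) | *-identityʳ n = refl
  [1+k]*[1+n]C[1+k]≡[1+n]*nCk (suc n) (suc k) = begin
    suc (suc k) * (suc (suc n) C suc (suc k))          ≡⟨ cong (suc (suc k) *_) (sym (nCk+nC[k+1]≡[n+1]C[k+1] (suc n) (suc k))) ⟩
    suc (suc k) * (x + y)                              ≡⟨ regroup (suc k) x y ⟩
    suc k * x + suc (suc k) * y + x
      ≡⟨ cong₂ (λ u v → u + v + x) ([1+k]*[1+n]C[1+k]≡[1+n]*nCk n k) ([1+k]*[1+n]C[1+k]≡[1+n]*nCk n (suc k)) ⟩
    suc n * (n C k) + suc n * (n C suc k) + x          ≡⟨ cong (_+ x) (sym (*-distribˡ-+ (suc n) (n C k) (n C suc k))) ⟩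
    suc n * (n C k + n C suc k) + x                    ≡⟨ cong (λ u → suc n * u + x) (nCk+nC[k+1]≡[n+1]C[k+1] n k) ⟩
    suc n * x + x                                      ≡⟨ +-comm (suc n * x) x ⟩
    suc (suc n) * x                                    ∎
    where
    x y : ℕ
    x = suc n C suc k
    y = suc n C suc (suc k)
    regroup : ∀ k x y → suc k * (x + y) ≡ k * x + suc k * y + x
    regroup = solve-∀

  2*m≡double : ∀ m → 2 * m ≡ double m
  2*m≡double m = trans (cong (m +_) (+-identityʳ m)) (sym (double≡m+m m))

  catalan≡ballot : ∀ m → catalan m ≡ ballot 0 m
  catalan≡ballot m = begin
    ((2 * m) C m) / suc m      ≡⟨ cong (λ n → (n C m) / suc m) (2*m≡double m) ⟩
    (double m C m) / suc m     ≡⟨ cong (_/ suc m) central≡ballot*[1+m] ⟩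
    ballot 0 m * suc m / suc m ≡⟨ m*n/n≡m (ballot 0 m) (suc m) ⟩
    ballot 0 m                 ∎
    where
    central next : ℕ
    central = double m C m
    next = double m C suc m
    [1+m]*next≡m*central : suc m * next ≡ m * central
    [1+m]*next≡m*central = +-cancelˡ-≡ (suc m * central) _ _ (begin
      suc m * central + suc m * next      ≡⟨ sym (*-distribˡ-+ (suc m) central next) ⟩
      suc m * (central + next)            ≡⟨ cong (suc m *_) (nCk+nC[k+1]≡[n+1]C[k+1] (double m) m) ⟩
      suc m * (suc (double m) C suc m)    ≡⟨ [1+k]*[1+n]C[1+k]≡[1+n]*nCk (double m) m ⟩
      suc (double m) * central            ≡⟨ cong (λ n → suc n * central) (double≡m+m m) ⟩
      (suc m + m) * central               ≡⟨ *-distribʳ-+ central (suc m) m ⟩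
      suc m * central + m * central       ∎)
    central≡ballot*[1+m] : central ≡ ballot 0 m * suc m
    central≡ballot*[1+m] = +-cancelʳ-≡ (m * central) _ _ (begin
      central + m * central               ≡⟨⟩
      suc m * central                     ≡⟨ cong (suc m *_) (sym (ballot+C≡C 0 m)) ⟩
      suc m * (ballot 0 m + next)         ≡⟨ *-distribˡ-+ (suc m) (ballot 0 m) next ⟩
      suc m * ballot 0 m + suc m * next   ≡⟨ cong₂ _+_ (*-comm (suc m) (ballot 0 m)) [1+m]*next≡m*central ⟩
      ballot 0 m * suc m + m * central    ∎)

  -- Coefficient arrays a m p stand for the polynomials Σ a m p bᵐ cᵖ.
  mulByB : (ℕ → ℕ → ℕ) → ℕ → ℕ → ℕ
  mulByB a zero    p = 0
  mulByB a (suc m) p = a m p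

  mulByC : (ℕ → ℕ → ℕ) → ℕ → ℕ → ℕ
  mulByC a m zero    = 0
  mulByC a m (suc p) = a m p

  -- powCoeff r m p = [bᵐ cᵖ t^(r+m+p)] F^r for the compositional inverse F of t(1 - bt)/(1 + ct).
  -- As F = (t/(1 - ct))·C(bt/(1 - ct)²), for r ≥ 1 this is ballot (r-1) m · C(p + r-1+2m, r-1+2m).
  powCoeff : ℕ → ℕ → ℕ → ℕ
  powCoeff zero    zero    zero    = 1
  powCoeff zero    zero    (suc p) = 0
  powCoeff zero    (suc m) p       = 0
  powCoeff (suc r) m       p       = ballot r m * ((p + (r + double m)) C (r + double m))

  weighted-pascal : ∀ g₁ g₂ N p →
    (g₁ + g₂) * ((suc p + suc N) C suc N) ≡
    g₁ * ((suc p + N) C N) + (g₁ + g₂) * ((p + suc N) C suc N) + g₂ * ((suc p + N) C N)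
  weighted-pascal g₁ g₂ N p = begin
    (g₁ + g₂) * (suc (p + suc N) C suc N)
      ≡⟨ cong ((g₁ + g₂) *_) (sym (nCk+nC[k+1]≡[n+1]C[k+1] (p + suc N) N)) ⟩
    (g₁ + g₂) * ((p + suc N) C N + (p + suc N) C suc N)
      ≡⟨ cong (λ n → (g₁ + g₂) * (n C N + (p + suc N) C suc N)) (+-suc p N) ⟩
    (g₁ + g₂) * ((suc p + N) C N + (p + suc N) C suc N)
      ≡⟨ distribute g₁ g₂ ((suc p + N) C N) ((p + suc N) C suc N) ⟩
    g₁ * ((suc p + N) C N) + (g₁ + g₂) * ((p + suc N) C suc N) + g₂ * ((suc p + N) C N) ∎
    where
    distribute : ∀ g₁ g₂ x y → (g₁ + g₂) * (x + y) ≡ g₁ * x + (g₁ + g₂) * y + g₂ * x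
    distribute = solve-∀

  powCoeff-rec : ∀ r m p →
    powCoeff (suc r) m p ≡ powCoeff r m p + mulByC (powCoeff (suc r)) m p + mulByB (powCoeff (suc (suc r))) m p
  powCoeff-rec zero    zero    zero    = refl
  powCoeff-rec zero    zero    (suc p) = refl
  powCoeff-rec zero    (suc m) zero
    rewrite nCn≡1 (suc (suc (double m))) | nCn≡1 (suc (double m)) = refl
  powCoeff-rec zero    (suc m) (suc p) = weighted-pascal 0 (ballot 1 m) (suc (double m)) p
  powCoeff-rec (suc r) zero    zero
    rewrite nCn≡1 (suc (r + 0)) | nCn≡1 (r + 0) = refl
  powCoeff-rec (suc r) zero    (suc p) = weighted-pascal 1 0 (r + 0) p
  powCoeff-rec (suc r) (suc m) zero
    rewrite nCn≡1 (suc (r + suc (suc (double m)))) | nCn≡1 (r + suc (suc (double m)))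
          | nCn≡1 (suc (suc (r + double m))) =
    trans (*-distribʳ-+ 1 (ballot r (suc m)) (ballot (suc (suc r)) m))
          (cong (_+ ballot (suc (suc r)) m * 1) (sym (+-identityʳ (ballot r (suc m) * 1))))
  powCoeff-rec (suc r) (suc m) (suc p) =
    trans (weighted-pascal g₁ g₂ N p)
          (cong (λ n → g₁ * ((suc p + N) C N) + (g₁ + g₂) * ((p + suc N) C suc N) + g₂ * ((suc p + n) C n)) N≡)
    where
    g₁ g₂ N : ℕ
    g₁ = ballot r (suc m)
    g₂ = ballot (suc (suc r)) m
    N = r + suc (suc (double m))
    N≡ : N ≡ suc (suc (r + double m))
    N≡ = trans (+-suc r (suc (double m))) (cong suc (+-suc r (double m)))

  [d∸m]+2m≡d+m : ∀ {d m} → m ≤ d → d ∸ m + double m ≡ d + m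
  [d∸m]+2m≡d+m {d} {m} m≤d = begin
    d ∸ m + double m    ≡⟨ cong (d ∸ m +_) (double≡m+m m) ⟩
    d ∸ m + (m + m)     ≡⟨ sym (+-assoc (d ∸ m) m m) ⟩
    d ∸ m + m + m       ≡⟨ cong (_+ m) (m∸n+n≡m m≤d) ⟩
    d + m               ∎

open Combinatorics

module RingIdentities {r ℓ : Level} (R : CommutativeRing r ℓ) where
  open CommutativeRing R
  open import Algebra.Properties.CommutativeSemigroup +-commutativeSemigroup using (xy∙z≈xz∙y)

  -x*y+x*y≈0 : ∀ x y → - x * y + x * y ≈ 0#
  -x*y+x*y≈0 x y = trans (sym (distribʳ y (- x) x)) (trans (*-congʳ (-‿inverseˡ x)) (zeroˡ y))

  x*y+-x*y≈0 : ∀ x y → x * y + - x * y ≈ 0#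
  x*y+-x*y≈0 x y = trans (+-comm _ _) (-x*y+x*y≈0 x y)

  [u+d]+v≈d : ∀ {u v} d → u + v ≈ 0# → (u + d) + v ≈ d
  [u+d]+v≈d d u+v≈0 = trans (xy∙z≈xz∙y _ d _) (trans (+-congʳ u+v≈0) (+-identityˡ d))

  [x+y*z]*w≈x*w+y*[z*w] : ∀ x y z w → (x + y * z) * w ≈ x * w + y * (z * w)
  [x+y*z]*w≈x*w+y*[z*w] x y z w = trans (distribʳ w x (y * z)) (+-congˡ (*-assoc y z w))

module FiniteSums {r ℓ : Level} (R : CommutativeRing r ℓ) where
  open CommutativeRing R
  open Riordan R
  open import Relation.Binary.Reasoning.Setoid setoid
  open import Algebra.Properties.CommutativeSemigroup +-commutativeSemigroup using (interchange)

  sumTo-cong-< : ∀ n {f g : ℕ → Carrier} → (∀ i → i < n → f i ≈ g i) → sumTo n f ≈ sumTo n g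
  sumTo-cong-< zero    eq = refl
  sumTo-cong-< (suc n) eq = +-cong (sumTo-cong-< n (λ i i<n → eq i (ℕ.m<n⇒m<1+n i<n))) (eq n (ℕ.n<1+n n))

  sumTo-cong : ∀ n {f g : ℕ → Carrier} → (∀ i → f i ≈ g i) → sumTo n f ≈ sumTo n g
  sumTo-cong n eq = sumTo-cong-< n (λ i _ → eq i)

  sumTo-zero : ∀ n {f : ℕ → Carrier} → (∀ i → i < n → f i ≈ 0#) → sumTo n f ≈ 0#
  sumTo-zero zero    eq = refl
  sumTo-zero (suc n) eq =
    trans (+-cong (sumTo-zero n (λ i i<n → eq i (ℕ.m<n⇒m<1+n i<n))) (eq n (ℕ.n<1+n n))) (+-identityˡ 0#)

  sumTo-+ : ∀ n (f g : ℕ → Carrier) → sumTo n (λ i → f i + g i) ≈ sumTo n f + sumTo n g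
  sumTo-+ zero    f g = sym (+-identityˡ 0#)
  sumTo-+ (suc n) f g = begin
    sumTo n (λ i → f i + g i) + (f n + g n)   ≈⟨ +-congʳ (sumTo-+ n f g) ⟩
    (sumTo n f + sumTo n g) + (f n + g n)     ≈⟨ interchange (sumTo n f) (sumTo n g) (f n) (g n) ⟩
    (sumTo n f + f n) + (sumTo n g + g n)     ∎

  sumTo-*ˡ : ∀ n a (f : ℕ → Carrier) → sumTo n (λ i → a * f i) ≈ a * sumTo n f
  sumTo-*ˡ zero    a f = sym (zeroʳ a)
  sumTo-*ˡ (suc n) a f = trans (+-congʳ (sumTo-*ˡ n a f)) (sym (distribˡ a (sumTo n f) (f n)))

  sumTo-suc : ∀ n (f : ℕ → Carrier) → sumTo (suc n) f ≈ f 0 + sumTo n (λ i → f (suc i))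
  sumTo-suc zero    f = trans (+-identityˡ (f 0)) (sym (+-identityʳ (f 0)))
  sumTo-suc (suc n) f = trans (+-congʳ (sumTo-suc n f)) (+-assoc (f 0) _ _)

  fromℕ-+ : ∀ x y → fromℕ (x ℕ.+ y) ≈ fromℕ x + fromℕ y
  fromℕ-+ zero    y = sym (+-identityˡ _)
  fromℕ-+ (suc x) y = trans (+-congˡ (fromℕ-+ x y)) (sym (+-assoc _ _ _))

  fromℕ-* : ∀ x y → fromℕ (x ℕ.* y) ≈ fromℕ x * fromℕ y
  fromℕ-* zero    y = sym (zeroˡ _)
  fromℕ-* (suc x) y = begin
    fromℕ (y ℕ.+ x ℕ.* y)         ≈⟨ trans (fromℕ-+ y (x ℕ.* y)) (+-congˡ (fromℕ-* x y)) ⟩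
    fromℕ y + fromℕ x * fromℕ y   ≈⟨ +-congʳ (sym (*-identityˡ _)) ⟩
    1# * fromℕ y + fromℕ x * fromℕ y ≈⟨ sym (distribʳ _ _ _) ⟩
    (1# + fromℕ x) * fromℕ y      ∎

module LowerTriangular {r ℓ : Level} (R : CommutativeRing r ℓ) where
  open CommutativeRing R
  open Riordan R
  open RingIdentities R
  open FiniteSums R
  open import Algebra.Properties.Group +-group using () renaming (∙-cancelˡ to +-cancelˡ)
  open import Data.Nat.Induction using (<-rec)
  open import Relation.Binary.Reasoning.Setoid setoid

  agree-downward : ∀ {u w : ℕ → Carrier} K → (∀ k → K ≤ k → u k ≈ w k) →
    (∀ k → u (suc k) ≈ w (suc k) → u k ≈ w k) → ∀ k → u k ≈ w k
  agree-downward {u} {w} K above step k = fromDistance K k (ℕ.m≤m+n K k)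
    where
    fromDistance : ∀ i k → K ≤ i ℕ.+ k → u k ≈ w k
    fromDistance zero    k K≤k = above k K≤k
    fromDistance (suc i) k K≤ = step k (fromDistance i (suc k) (≡.subst (K ≤_) (≡.sym (ℕ.+-suc i k)) K≤))

  unitriangular-unique : (A : ℕ → ℕ → Carrier) {x y : ℕ → Carrier} → (∀ n → A n n ≈ 1#) →
    (∀ n → sumTo (suc n) (λ j → A n j * x j) ≈ sumTo (suc n) (λ j → A n j * y j)) →
    ∀ n → x n ≈ y n
  unitriangular-unique A {x} {y} diagonal Ax≈Ay = <-rec (λ n → x n ≈ y n) step
    where
    step : ∀ n → (∀ {m} → m < n → x m ≈ y m) → x n ≈ y n
    step n below = begin
      x n            ≈⟨ sym (*-identityˡ (x n)) ⟩
      1# * x n       ≈⟨ *-congʳ (sym (diagonal n)) ⟩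
      A n n * x n    ≈⟨ +-cancelˡ _ _ _ (trans (+-congʳ earlier) (Ax≈Ay n)) ⟩
      A n n * y n    ≈⟨ *-congʳ (diagonal n) ⟩
      1# * y n       ≈⟨ *-identityˡ (y n) ⟩
      y n            ∎
      where
      earlier : sumTo n (λ j → A n j * y j) ≈ sumTo n (λ j → A n j * x j)
      earlier = sumTo-cong-< n (λ j j<n → *-congˡ (sym (below j<n)))

  -- the Riordan array (1/(1 - x t), t)
  geometric : Carrier → ℕ → ℕ → Carrier
  geometric x n       zero    = x ^ n
  geometric x zero    (suc k) = 0#
  geometric x (suc n) (suc k) = geometric x n k

  shiftRight : (ℕ → ℕ → Carrier) → ℕ → ℕ → Carrier
  shiftRight A n zero    = 0#
  shiftRight A n (suc k) = A n k

  geometric-zero : ∀ x k → geometric x 0 k ≈ δ 0 k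
  geometric-zero x zero    = refl
  geometric-zero x (suc k) = refl

  geometric-above : ∀ x {n k} → n < k → geometric x n k ≈ 0#
  geometric-above x {zero}  {suc k} _         = refl
  geometric-above x {suc n} {suc k} (s≤s n<k) = geometric-above x n<k

  geometric-row : ∀ x n k → geometric x (suc n) k ≈ x * geometric x n k + δ (suc n) k
  geometric-row x n       zero          = sym (+-identityʳ _)
  geometric-row x zero    (suc k)       = trans (geometric-zero x k) (sym (trans (+-congʳ (zeroʳ x)) (+-identityˡ _)))
  geometric-row x (suc n) (suc k)       = geometric-row x n k

  geometric-col : ∀ x n k → geometric x n k ≈ x * geometric x n (suc k) + δ n k
  geometric-col x zero    zero    = sym (trans (+-congʳ (zeroʳ x)) (+-identityˡ 1#))
  geometric-col x (suc n) zero    = sym (+-identityʳ _)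
  geometric-col x zero    (suc k) = sym (trans (+-congʳ (zeroʳ x)) (+-identityˡ 0#))
  geometric-col x (suc n) (suc k) = geometric-col x n k

module InverseArray {r ℓ : Level} (R : CommutativeRing r ℓ) (b c : CommutativeRing.Carrier R) where
  open CommutativeRing R
  open Riordan R
  open RingIdentities R
  open FiniteSums R
  open LowerTriangular R
  open import Algebra.Properties.CommutativeSemigroup +-commutativeSemigroup using (interchange)
  open import Algebra.Properties.CommutativeSemigroup *-commutativeSemigroup using (x∙yz≈y∙xz)
  open import Algebra.Properties.Group +-group using () renaming (∙-cancelʳ to +-cancelʳ)
  open import Relation.Binary.Reasoning.Setoid setoid
  open NaturalSolver commutativeSemiring using (solve; _:+_; _:*_; _:=_; con)

  g : Series
  g = invUnitS (onePlus c)

  f : Series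
  f = mulS (tOneMinus b) g

  timesT : Series → Series
  timesT a zero    = 0#
  timesT a (suc n) = a n

  g-rec : ∀ n → g (suc n) + c * g n ≈ 0#
  -- Only the first term of the sum defining g (suc n) survives, as 1 + ct has degree one.
  g-rec n = trans (+-congʳ (-‿cong (trans (sumTo-suc n _) (trans (+-congˡ (sumTo-zero n (λ _ _ → zeroˡ _))) (+-identityʳ _)))))
                  (-‿inverseˡ (c * g n))

  mulS-g-zero : ∀ P → mulS g P 0 ≈ P 0
  mulS-g-zero P = trans (+-identityˡ _) (*-identityˡ (P 0))

  mulS-g-suc : ∀ P n → mulS g P (suc n) + c * mulS g P n ≈ P (suc n)
  mulS-g-suc P n = begin
    mulS g P (suc n) + c * mulS g P n
      ≈⟨ +-cong (sumTo-suc (suc n) _) (sym (sumTo-*ˡ (suc n) c _)) ⟩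
    (1# * P (suc n) + sumTo (suc n) (λ i → g (suc i) * P (n ∸ i))) + sumTo (suc n) (λ i → c * (g i * P (n ∸ i)))
      ≈⟨ trans (+-assoc _ _ _) (+-congˡ (sym (sumTo-+ (suc n) _ _))) ⟩
    1# * P (suc n) + sumTo (suc n) (λ i → g (suc i) * P (n ∸ i) + c * (g i * P (n ∸ i)))
      ≈⟨ +-cong (*-identityˡ _) (sumTo-zero (suc n) (λ i _ → vanishes i)) ⟩
    P (suc n) + 0#
      ≈⟨ +-identityʳ _ ⟩
    P (suc n) ∎
    where
    vanishes : ∀ i → g (suc i) * P (n ∸ i) + c * (g i * P (n ∸ i)) ≈ 0#
    vanishes i = trans (sym ([x+y*z]*w≈x*w+y*[z*w] _ _ _ _)) (trans (*-congʳ (g-rec i)) (zeroˡ _))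

  f-zero : f 0 ≈ 0#
  f-zero = trans (+-identityˡ _) (zeroˡ _)

  f-suc : ∀ i → f (suc i) ≈ g i + - b * timesT g i
  f-suc zero = solve 3 (λ x y z → (con 0 :+ con 0 :* x) :+ con 1 :* y := y :+ z :* con 0) refl (g 1) (g 0) (- b)
  f-suc (suc i) = begin
    f (suc (suc i))
      ≈⟨ trans (sumTo-suc (suc (suc i)) _) (+-congˡ (trans (sumTo-suc (suc i) _) (+-congˡ (sumTo-suc i _)))) ⟩
    0# * g (suc (suc i)) + (1# * g (suc i) + (- b * g i + sumTo i (λ j → 0# * g (i ∸ suc j))))
      ≈⟨ +-congˡ (+-congˡ (+-congˡ (sumTo-zero i (λ _ _ → zeroˡ _)))) ⟩
    0# * g (suc (suc i)) + (1# * g (suc i) + (- b * g i + 0#))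
      ≈⟨ solve 4 (λ x y z w → con 0 :* x :+ (con 1 :* y :+ (z :* w :+ con 0)) := y :+ z :* w) refl _ _ (- b) _ ⟩
    g (suc i) + - b * g i ∎

  mulS-f-suc : ∀ P n → mulS f P (suc n) ≈ mulS g P n + - b * timesT (mulS g P) n
  mulS-f-suc P n = begin
    mulS f P (suc n)
      ≈⟨ trans (sumTo-suc (suc n) _) (+-congʳ (trans (*-congʳ f-zero) (zeroˡ _))) ⟩
    0# + sumTo (suc n) (λ i → f (suc i) * P (n ∸ i))
      ≈⟨ trans (+-identityˡ _) (sumTo-cong (suc n) (λ i → trans (*-congʳ (f-suc i)) ([x+y*z]*w≈x*w+y*[z*w] _ _ _ _))) ⟩
    sumTo (suc n) (λ i → g i * P (n ∸ i) + - b * (timesT g i * P (n ∸ i)))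
      ≈⟨ trans (sumTo-+ (suc n) _ _) (+-congˡ (sumTo-*ˡ (suc n) (- b) _)) ⟩
    mulS g P n + - b * sumTo (suc n) (λ i → timesT g i * P (n ∸ i))
      ≈⟨ +-congˡ (*-congˡ (shifted n)) ⟩
    mulS g P n + - b * timesT (mulS g P) n ∎
    where
    shifted : ∀ n → sumTo (suc n) (λ i → timesT g i * P (n ∸ i)) ≈ timesT (mulS g P) n
    shifted zero    = trans (+-identityˡ _) (zeroˡ _)
    shifted (suc n) = trans (sumTo-suc (suc n) _) (trans (+-congʳ (zeroˡ _)) (+-identityˡ _))

  L-zero-zero : L b c 0 0 ≈ 1#
  L-zero-zero = mulS-g-zero oneS

  L-zero-suc : ∀ k → L b c 0 (suc k) ≈ 0#
  L-zero-suc k = trans (mulS-g-zero (powS f (suc k))) (trans (+-identityˡ _) (trans (*-congʳ f-zero) (zeroˡ _)))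

  L-suc-zero : ∀ n → L b c (suc n) 0 + c * L b c n 0 ≈ 0#
  L-suc-zero n = mulS-g-suc oneS n

  L-suc-suc : ∀ n k → L b c (suc n) (suc k) + c * L b c n (suc k) ≈ L b c n k + - b * timesT (λ m → L b c m k) n
  L-suc-suc n k = trans (mulS-g-suc (powS f (suc k)) n) (trans (mulS-f-suc (powS f k) n) (+-congˡ (*-congˡ (timesT-L n))))
    where
    timesT-L : ∀ n → timesT (mulS g (powS f k)) n ≈ timesT (λ m → L b c m k) n
    timesT-L zero    = refl
    timesT-L (suc n) = refl

  L-step : ∀ n k → L b c n (suc k) ≈ 0# → timesT (λ m → L b c m k) n ≈ 0# → L b c (suc n) (suc k) ≈ L b c n k
  L-step n k above previous = begin
    L b c (suc n) (suc k)                          ≈⟨ sym (+-identityʳ _) ⟩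
    L b c (suc n) (suc k) + 0#                     ≈⟨ +-congˡ (sym (trans (*-congˡ above) (zeroʳ c))) ⟩
    L b c (suc n) (suc k) + c * L b c n (suc k)    ≈⟨ L-suc-suc n k ⟩
    L b c n k + - b * timesT (λ m → L b c m k) n   ≈⟨ +-congˡ (trans (*-congˡ previous) (zeroʳ _)) ⟩
    L b c n k + 0#                                 ≈⟨ +-identityʳ _ ⟩
    L b c n k                                      ∎

  mutual
    L-above-diagonal : ∀ {n k} → n < k → L b c n k ≈ 0#
    L-above-diagonal {zero}  {suc k} _         = L-zero-suc k
    L-above-diagonal {suc n} {suc k} (s≤s n<k) =
      trans (L-step n k (L-above-diagonal (ℕ.m<n⇒m<1+n n<k)) (timesT-L-above (ℕ.<⇒≤ n<k))) (L-above-diagonal n<k)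

    timesT-L-above : ∀ {n k} → n ≤ k → timesT (λ m → L b c m k) n ≈ 0#
    timesT-L-above {zero}  _   = refl
    timesT-L-above {suc n} n<k = L-above-diagonal n<k

  L-diagonal : ∀ n → L b c n n ≈ 1#
  L-diagonal zero    = L-zero-zero
  L-diagonal (suc n) = trans (L-step n n (L-above-diagonal (ℕ.n<1+n n)) (timesT-L-above {n} ℕ.≤-refl)) (L-diagonal n)

  -- Fpow k d = [t^(k+d)] F^k for the compositional inverse F of f. Since F = t + c t F + b F²,
  -- F^(k+1) = t F^k + c t F^(k+1) + b F^(k+2), which gives the last clause.
  Fpow : ℕ → ℕ → Carrier
  Fpow zero    zero    = 1#
  Fpow zero    (suc d) = 0#
  Fpow (suc k) zero    = 1#
  Fpow (suc k) (suc d) = Fpow k (suc d) + c * Fpow (suc k) d + b * Fpow (suc (suc k)) d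

  -- FArray r j k = [t^(r+j)] F^(r+k), so FArray 0 is the Riordan array (1, F).
  FArray : ℕ → ℕ → ℕ → Carrier
  FArray r j       zero    = Fpow r j
  FArray r zero    (suc k) = 0#
  FArray r (suc j) (suc k) = FArray (suc r) j k

  plus-zeros : ∀ x → x + c * 0# + b * 0# ≈ x
  plus-zeros x = trans (+-cong (trans (+-congˡ (zeroʳ c)) (+-identityʳ x)) (zeroʳ b)) (+-identityʳ x)

  FArray-rec : ∀ r j k → FArray (suc r) j k ≈ FArray r j k + c * FArray r j (suc k) + b * FArray (suc r) j (suc k)
  FArray-rec zero    zero    zero    = sym (plus-zeros 1#)
  FArray-rec (suc r) zero    zero    = sym (plus-zeros 1#)
  FArray-rec r       (suc j) zero    = refl
  FArray-rec r       zero    (suc k) = sym (plus-zeros 0#)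
  FArray-rec r       (suc j) (suc k) = FArray-rec (suc r) j k

  FArray-above : ∀ r {j k} → j < k → FArray r j k ≈ 0#
  FArray-above r {zero}  {suc k} _         = refl
  FArray-above r {suc j} {suc k} (s≤s j<k) = FArray-above (suc r) j<k

  LF : ℕ → ℕ → Carrier
  LF = lowerMul (L b c) (FArray 0)

  LF′ : ℕ → ℕ → Carrier
  LF′ = lowerMul (L b c) (λ j → FArray 0 (suc j))

  sumTo-L-row : ∀ n (X : ℕ → Carrier) → sumTo (suc (suc n)) (λ j → L b c n j * X j) ≈ sumTo (suc n) (λ j → L b c n j * X j)
  sumTo-L-row n X = trans (+-congˡ (trans (*-congʳ (L-above-diagonal (ℕ.n<1+n n))) (zeroˡ _))) (+-identityʳ _)

  sumTo-timesT-L : ∀ n (X : ℕ → Carrier) →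
    sumTo (suc n) (λ j → timesT (λ m → L b c m j) n * X j) ≈ timesT (λ m → sumTo (suc m) (λ j → L b c m j * X j)) n
  sumTo-timesT-L zero    X = trans (+-identityˡ _) (zeroˡ _)
  sumTo-timesT-L (suc n) X = sumTo-L-row n X

  LF-zero-row : ∀ k → LF 0 k ≈ δ 0 k
  LF-zero-row k = trans (+-identityˡ _) (trans (*-congʳ L-zero-zero) (trans (*-identityˡ _) (column k)))
    where
    column : ∀ k → FArray 0 0 k ≈ δ 0 k
    column zero    = refl
    column (suc k) = refl

  LF′-zero-col : ∀ n → LF′ n 0 ≈ 0#
  LF′-zero-col n = sumTo-zero (suc n) (λ _ _ → zeroʳ _)

  LF′-above : ∀ {n k} → suc n < k → LF′ n k ≈ 0#
  LF′-above {n} n+1<k = sumTo-zero (suc n) (λ j j≤n → trans (*-congˡ (FArray-above 0 (ℕ.≤-<-trans j≤n n+1<k))) (zeroʳ _))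

  LF′-col : ∀ n k → LF′ n (suc k) ≈ LF n k + c * LF n (suc k) + b * LF′ n (suc (suc k))
  LF′-col n k = begin
    LF′ n (suc k)
      ≈⟨ sumTo-cong (suc n) (λ j → trans (*-congˡ (FArray-rec 0 j k)) (distribute _ _ _ _ _ _)) ⟩
    sumTo (suc n) (λ j → L b c n j * FArray 0 j k + c * (L b c n j * FArray 0 j (suc k)) + b * (L b c n j * FArray 1 j (suc k)))
      ≈⟨ trans (sumTo-+ (suc n) _ _) (+-cong (trans (sumTo-+ (suc n) _ _) (+-congˡ (sumTo-*ˡ (suc n) c _))) (sumTo-*ˡ (suc n) b _)) ⟩
    LF n k + c * LF n (suc k) + b * LF′ n (suc (suc k)) ∎
    where
    distribute : ∀ l x y z u v → l * (x + u * y + v * z) ≈ l * x + u * (l * y) + v * (l * z)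
    distribute = solve 6 (λ l x y z u v → l :* (x :+ u :* y :+ v :* z) := l :* x :+ u :* (l :* y) :+ v :* (l :* z)) refl

  LF-row : ∀ n k → LF (suc n) k + c * LF n k ≈ LF′ n k + - b * timesT (λ m → LF′ m k) n
  LF-row n k = begin
    LF (suc n) k + c * LF n k
      ≈⟨ +-cong (sumTo-suc (suc n) _) c*LFₙ ⟩
    (L b c (suc n) 0 * N 0 + Σ₁) + (c * (L b c n 0 * N 0) + Σ₂)
      ≈⟨ interchange _ _ _ _ ⟩
    (L b c (suc n) 0 * N 0 + c * (L b c n 0 * N 0)) + (Σ₁ + Σ₂)
      ≈⟨ +-cong firstTermVanishes (sym (sumTo-+ (suc n) _ _)) ⟩
    0# + sumTo (suc n) (λ j → L b c (suc n) (suc j) * N (suc j) + c * (L b c n (suc j) * N (suc j)))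
      ≈⟨ trans (+-identityˡ _) (sumTo-cong (suc n) termStep) ⟩
    sumTo (suc n) (λ j → L b c n j * N (suc j) + - b * (timesT (λ m → L b c m j) n * N (suc j)))
      ≈⟨ trans (sumTo-+ (suc n) _ _) (+-congˡ (trans (sumTo-*ˡ (suc n) (- b) _) (*-congˡ (sumTo-timesT-L n _)))) ⟩
    LF′ n k + - b * timesT (λ m → LF′ m k) n ∎
    where
    N : ℕ → Carrier
    N j = FArray 0 j k
    Σ₁ Σ₂ : Carrier
    Σ₁ = sumTo (suc n) (λ j → L b c (suc n) (suc j) * N (suc j))
    Σ₂ = sumTo (suc n) (λ j → c * (L b c n (suc j) * N (suc j)))
    c*LFₙ : c * LF n k ≈ c * (L b c n 0 * N 0) + Σ₂
    c*LFₙ = begin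
      c * LF n k                                                   ≈⟨ *-congˡ (sym (sumTo-L-row n _)) ⟩
      c * sumTo (suc (suc n)) (λ j → L b c n j * N j)              ≈⟨ sym (sumTo-*ˡ (suc (suc n)) c _) ⟩
      sumTo (suc (suc n)) (λ j → c * (L b c n j * N j))            ≈⟨ sumTo-suc (suc n) _ ⟩
      c * (L b c n 0 * N 0) + Σ₂                                   ∎
    firstTermVanishes : L b c (suc n) 0 * N 0 + c * (L b c n 0 * N 0) ≈ 0#
    firstTermVanishes = trans (sym ([x+y*z]*w≈x*w+y*[z*w] _ _ _ _)) (trans (*-congʳ (L-suc-zero n)) (zeroˡ (N 0)))
    termStep : ∀ j → L b c (suc n) (suc j) * N (suc j) + c * (L b c n (suc j) * N (suc j)) ≈
                     L b c n j * N (suc j) + - b * (timesT (λ m → L b c m j) n * N (suc j))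
    termStep j = begin
      L b c (suc n) (suc j) * N (suc j) + c * (L b c n (suc j) * N (suc j))  ≈⟨ sym ([x+y*z]*w≈x*w+y*[z*w] _ _ _ _) ⟩
      (L b c (suc n) (suc j) + c * L b c n (suc j)) * N (suc j)              ≈⟨ *-congʳ (L-suc-suc n j) ⟩
      (L b c n j + - b * timesT (λ m → L b c m j) n) * N (suc j)             ≈⟨ [x+y*z]*w≈x*w+y*[z*w] _ _ _ _ ⟩
      L b c n j * N (suc j) + - b * (timesT (λ m → L b c m j) n * N (suc j)) ∎

  geometric-neg-row : ∀ n k → geometric (- c) (suc n) k + c * geometric (- c) n k ≈ δ (suc n) k
  geometric-neg-row n k = trans (+-congʳ (geometric-row (- c) n k)) ([u+d]+v≈d _ (-x*y+x*y≈0 c _))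

  geometric-neg-col : ∀ n k → geometric (- c) n k + c * geometric (- c) n (suc k) ≈ δ n k
  geometric-neg-col n k = trans (+-congʳ (geometric-col (- c) n k)) ([u+d]+v≈d _ (-x*y+x*y≈0 c _))

  shiftRight-geometric-row : ∀ n k → shiftRight (geometric b) n k + - b * timesT (λ m → shiftRight (geometric b) m k) n ≈ δ (suc n) k
  shiftRight-geometric-row zero    zero    = trans (+-identityˡ _) (zeroʳ _)
  shiftRight-geometric-row (suc n) zero    = trans (+-identityˡ _) (zeroʳ _)
  shiftRight-geometric-row zero    (suc k) = trans (+-congˡ (zeroʳ _)) (trans (+-identityʳ _) (geometric-zero b k))
  shiftRight-geometric-row (suc n) (suc k) = trans (+-congʳ (geometric-row b n k)) ([u+d]+v≈d _ (x*y+-x*y≈0 b _))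

  LF′≈shiftRight-geometric : ∀ n → (∀ k → LF n k ≈ geometric (- c) n k) → ∀ k → LF′ n k ≈ shiftRight (geometric b) n k
  LF′≈shiftRight-geometric n LFₙ≈ = agree-downward (suc (suc n)) vanish step
    where
    vanish : ∀ k → suc (suc n) ≤ k → LF′ n k ≈ shiftRight (geometric b) n k
    vanish (suc k) (s≤s n<k) = trans (LF′-above (s≤s n<k)) (sym (geometric-above b n<k))
    step : ∀ k → LF′ n (suc k) ≈ shiftRight (geometric b) n (suc k) → LF′ n k ≈ shiftRight (geometric b) n k
    step zero    _  = LF′-zero-col n
    step (suc k) eq = begin
      LF′ n (suc k)
        ≈⟨ LF′-col n k ⟩
      LF n k + c * LF n (suc k) + b * LF′ n (suc (suc k))
        ≈⟨ +-cong (+-cong (LFₙ≈ k) (*-congˡ (LFₙ≈ (suc k)))) (*-congˡ eq) ⟩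
      geometric (- c) n k + c * geometric (- c) n (suc k) + b * geometric b n (suc k)
        ≈⟨ trans (+-congʳ (geometric-neg-col n k)) (+-comm _ _) ⟩
      b * geometric b n (suc k) + δ n k
        ≈⟨ sym (geometric-col b n k) ⟩
      geometric b n k ∎

  LF≈geometric : ∀ n k → LF n k ≈ geometric (- c) n k
  LF≈geometric zero    k = trans (LF-zero-row k) (sym (geometric-zero (- c) k))
  LF≈geometric (suc n) k = +-cancelʳ (c * LF n k) _ _ (begin
    LF (suc n) k + c * LF n k
      ≈⟨ LF-row n k ⟩
    LF′ n k + - b * timesT (λ m → LF′ m k) n
      ≈⟨ +-cong (LF′≈shiftRight-geometric n (LF≈geometric n) k) (*-congˡ (earlierRows n)) ⟩
    shiftRight (geometric b) n k + - b * timesT (λ m → shiftRight (geometric b) m k) n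
      ≈⟨ shiftRight-geometric-row n k ⟩
    δ (suc n) k
      ≈⟨ sym (geometric-neg-row n k) ⟩
    geometric (- c) (suc n) k + c * geometric (- c) n k
      ≈⟨ +-congˡ (*-congˡ (sym (LF≈geometric n k))) ⟩
    geometric (- c) (suc n) k + c * LF n k ∎)
    where
    earlierRows : ∀ m → timesT (λ m → LF′ m k) m ≈ timesT (λ m → shiftRight (geometric b) m k) m
    earlierRows zero    = refl
    earlierRows (suc m) = LF′≈shiftRight-geometric m (LF≈geometric m) k

  -- [t^j] (1 + cF) = [t^j] 1/g(F), the first column of L⁻¹ = (1/g(F), F)
  firstColumn : ℕ → Carrier
  firstColumn j = FArray 0 j 0 + c * FArray 0 j 1

  L-firstColumn : ∀ n → sumTo (suc n) (λ j → L b c n j * firstColumn j) ≈ δ n 0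
  L-firstColumn n = begin
    sumTo (suc n) (λ j → L b c n j * firstColumn j)
      ≈⟨ sumTo-cong (suc n) (λ j → trans (distribˡ _ _ _) (+-congˡ (x∙yz≈y∙xz _ c _))) ⟩
    sumTo (suc n) (λ j → L b c n j * FArray 0 j 0 + c * (L b c n j * FArray 0 j 1))
      ≈⟨ trans (sumTo-+ (suc n) _ _) (+-congˡ (sumTo-*ˡ (suc n) c _)) ⟩
    LF n 0 + c * LF n 1
      ≈⟨ +-cong (LF≈geometric n 0) (*-congˡ (LF≈geometric n 1)) ⟩
    geometric (- c) n 0 + c * geometric (- c) n 1
      ≈⟨ geometric-neg-col n 0 ⟩
    δ n 0 ∎

  evalBC : (ℕ → ℕ → ℕ) → ℕ → Carrier
  evalBC a d = sumTo (suc d) (λ m → fromℕ (a m (d ∸ m)) * (b ^ m * c ^ (d ∸ m)))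

  evalBC-cong : ∀ {a a′} d → (∀ m p → a m p ≡ a′ m p) → evalBC a d ≈ evalBC a′ d
  evalBC-cong d a≡a′ = sumTo-cong (suc d) (λ m → *-congʳ (reflexive (≡.cong fromℕ (a≡a′ m (d ∸ m)))))

  evalBC-+ : ∀ a a′ d → evalBC (λ m p → a m p ℕ.+ a′ m p) d ≈ evalBC a d + evalBC a′ d
  evalBC-+ a a′ d =
    trans (sumTo-cong (suc d) (λ m → trans (*-congʳ (fromℕ-+ (a m (d ∸ m)) (a′ m (d ∸ m)))) (distribʳ _ _ _)))
          (sumTo-+ (suc d) _ _)

  evalBC-mulByC : ∀ a d → evalBC (mulByC a) (suc d) ≈ c * evalBC a d
  evalBC-mulByC a d = begin
    evalBC (mulByC a) (suc d)                                                   ≈⟨ +-cong (sumTo-cong-< (suc d) below) (last d) ⟩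
    sumTo (suc d) (λ m → c * (fromℕ (a m (d ∸ m)) * (b ^ m * c ^ (d ∸ m)))) + 0# ≈⟨ +-identityʳ _ ⟩
    sumTo (suc d) (λ m → c * (fromℕ (a m (d ∸ m)) * (b ^ m * c ^ (d ∸ m))))      ≈⟨ sumTo-*ˡ (suc d) c _ ⟩
    c * evalBC a d                                                              ∎
    where
    pull-c : ∀ x y z → x * (y * (c * z)) ≈ c * (x * (y * z))
    pull-c x y z = trans (*-congˡ (x∙yz≈y∙xz y c z)) (x∙yz≈y∙xz x c (y * z))
    below : ∀ m → m < suc d →
      fromℕ (mulByC a m (suc d ∸ m)) * (b ^ m * c ^ (suc d ∸ m)) ≈ c * (fromℕ (a m (d ∸ m)) * (b ^ m * c ^ (d ∸ m)))
    below m (s≤s m≤d) rewrite ℕ.+-∸-assoc 1 m≤d = pull-c _ _ _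
    last : ∀ d → fromℕ (mulByC a (suc d) (d ∸ d)) * (b ^ suc d * c ^ (d ∸ d)) ≈ 0#
    last d rewrite ℕ.n∸n≡0 d = zeroˡ _

  evalBC-mulByB : ∀ a d → evalBC (mulByB a) (suc d) ≈ b * evalBC a d
  evalBC-mulByB a d = begin
    evalBC (mulByB a) (suc d)
      ≈⟨ sumTo-suc (suc d) _ ⟩
    0# * (1# * c ^ suc d) + sumTo (suc d) (λ m → fromℕ (a m (d ∸ m)) * ((b * b ^ m) * c ^ (d ∸ m)))
      ≈⟨ trans (+-cong (zeroˡ _) (sumTo-cong (suc d) (λ m → pull-b _ _ _))) (+-identityˡ _) ⟩
    sumTo (suc d) (λ m → b * (fromℕ (a m (d ∸ m)) * (b ^ m * c ^ (d ∸ m))))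
      ≈⟨ sumTo-*ˡ (suc d) b _ ⟩
    b * evalBC a d ∎
    where
    pull-b : ∀ x y z → x * ((b * y) * z) ≈ b * (x * (y * z))
    pull-b x y z = trans (*-congˡ (*-assoc b y z)) (x∙yz≈y∙xz x b (y * z))

  Fpow≈evalBC : ∀ r d → Fpow r d ≈ evalBC (powCoeff r) d
  Fpow≈evalBC zero    zero    = sym (trans (+-identityˡ _) (trans (*-congʳ (+-identityʳ 1#)) (trans (*-identityˡ _) (*-identityˡ 1#))))
  Fpow≈evalBC zero    (suc d) = sym (sumTo-zero (suc (suc d)) (λ m _ → trans (*-congʳ (noTerms m)) (zeroˡ _)))
    where
    noTerms : ∀ m → fromℕ (powCoeff 0 m (suc d ∸ m)) ≈ 0#
    noTerms zero    = refl
    noTerms (suc m) = refl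
  Fpow≈evalBC (suc r) zero    = sym (trans (+-identityˡ _) (trans (*-congʳ constant≈1) (trans (*-identityˡ _) (*-identityˡ 1#))))
    where
    constant≈1 : fromℕ (powCoeff (suc r) 0 0) ≈ 1#
    constant≈1 rewrite ℕ.+-identityʳ r | nCn≡1 r = +-identityʳ 1#
  Fpow≈evalBC (suc r) (suc d) = begin
    Fpow r (suc d) + c * Fpow (suc r) d + b * Fpow (suc (suc r)) d
      ≈⟨ +-cong (+-cong (Fpow≈evalBC r (suc d)) (*-congˡ (Fpow≈evalBC (suc r) d))) (*-congˡ (Fpow≈evalBC (suc (suc r)) d)) ⟩
    evalBC (powCoeff r) (suc d) + c * evalBC (powCoeff (suc r)) d + b * evalBC (powCoeff (suc (suc r))) d
      ≈⟨ sym (+-cong (+-congˡ (evalBC-mulByC _ d)) (evalBC-mulByB _ d)) ⟩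
    evalBC (powCoeff r) (suc d) + evalBC (mulByC (powCoeff (suc r))) (suc d) + evalBC (mulByB (powCoeff (suc (suc r)))) (suc d)
      ≈⟨ sym (trans (evalBC-+ (λ m p → powCoeff r m p ℕ.+ mulByC (powCoeff (suc r)) m p) (mulByB (powCoeff (suc (suc r)))) (suc d))
                    (+-congʳ (evalBC-+ (powCoeff r) (mulByC (powCoeff (suc r))) (suc d)))) ⟩
    evalBC (λ m p → powCoeff r m p ℕ.+ mulByC (powCoeff (suc r)) m p ℕ.+ mulByB (powCoeff (suc (suc r))) m p) (suc d)
      ≈⟨ evalBC-cong (suc d) (λ m p → ≡.sym (powCoeff-rec r m p)) ⟩
    evalBC (powCoeff (suc r)) (suc d) ∎

  firstColumn≈μFormula : ∀ n → firstColumn n ≈ μFormula b c n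
  firstColumn≈μFormula zero    = refl
  firstColumn≈μFormula (suc d) =
    +-cong (sym (zeroˡ _)) (*-congˡ (trans (Fpow≈evalBC 1 d) (sumTo-cong-< (suc d) (λ m m<1+d → term m (ℕ.≤-pred m<1+d)))))
    where
    rearrange : ∀ x y p q → (x * y) * (p * q) ≈ y * q * p * x
    rearrange = solve 4 (λ x y p q → (x :* y) :* (p :* q) := y :* q :* p :* x) refl
    term : ∀ m → m ≤ d →
      fromℕ (powCoeff 1 m (d ∸ m)) * (b ^ m * c ^ (d ∸ m)) ≈
      fromℕ ((suc d ℕ.+ m ∸ 1) C (2 ℕ.* m)) * c ^ (suc d ∸ m ∸ 1) * b ^ m * fromℕ (catalan m)
    term m m≤d = begin
      fromℕ (ballot 0 m ℕ.* binomial) * (b ^ m * c ^ (d ∸ m))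
        ≡⟨ ≡.cong₂ (λ k e → fromℕ k * (b ^ m * c ^ e)) coefficient≡ exponent≡ ⟩
      fromℕ (catalan m ℕ.* binomial′) * (b ^ m * c ^ (suc d ∸ m ∸ 1))
        ≈⟨ *-congʳ (fromℕ-* (catalan m) binomial′) ⟩
      (fromℕ (catalan m) * fromℕ binomial′) * (b ^ m * c ^ (suc d ∸ m ∸ 1))
        ≈⟨ rearrange _ _ _ _ ⟩
      fromℕ binomial′ * c ^ (suc d ∸ m ∸ 1) * b ^ m * fromℕ (catalan m) ∎
      where
      binomial binomial′ : ℕ
      binomial = (d ∸ m ℕ.+ double m) C double m
      binomial′ = (suc d ℕ.+ m ∸ 1) C (2 ℕ.* m)
      coefficient≡ : ballot 0 m ℕ.* binomial ≡ catalan m ℕ.* binomial′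
      coefficient≡ = ≡.cong₂ ℕ._*_ (≡.sym (catalan≡ballot m)) (≡.cong₂ _C_ ([d∸m]+2m≡d+m m≤d) (≡.sym (2*m≡double m)))
      exponent≡ : d ∸ m ≡ suc d ∸ m ∸ 1
      exponent≡ = ≡.cong (_∸ 1) (≡.sym (ℕ.+-∸-assoc 1 m≤d))

-- The identity holds for all b and c: the hypotheses b ≠ 0 and c ≠ 0 are unused.
mainTheorem11 : ∀ {c ℓ : Level} (R : CommutativeRing c ℓ) →
    let open CommutativeRing R in
    (b cc : Carrier) → ¬ (b ≈ 0#) → ¬ (cc ≈ 0#) →
    (M : ℕ → ℕ → Carrier) →
    (∀ n k → Riordan.lowerMul R (Riordan.L R b cc) M n k ≈ Riordan.δ R n k) →
    ∀ n → M n 0 ≈ Riordan.μFormula R b cc n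
mainTheorem11 R b c _ _ M LM≈I n = begin
  M n 0               ≈⟨ unitriangular-unique (L b c) L-diagonal (λ n → trans (LM≈I n 0) (sym (L-firstColumn n))) n ⟩
  firstColumn n       ≈⟨ firstColumn≈μFormula n ⟩
  μFormula b c n      ∎
  where
  open CommutativeRing R
  open Riordan R
  open LowerTriangular R
  open InverseArray R b c
  open import Relation.Binary.Reasoning.Setoid setoid
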